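{- The set $$\mathcal{S}=\left\{\begin{pmatrix}a&b\\ c&d\end{pmatrix}\in\mathrm{SL}_2(\mathbb{Z})\ :\ 0<a<b<d,\ 0<a<c<d\right\}$$ is closed under matrix multiplication, i.e. it is a semigroup. -}

module Defs where

open import Data.Integer using (ℤ; _+_; _-_; _*_; _<_; +_)
open import Data.Product using (_×_)
open import Relation.Binary.PropositionalEquality using (_≡_)

record Mat2 : Set where
  constructor mat
  field
    a b c d : ℤ

open Mat2 public

_·_ : Mat2 → Mat2 → Mat2
mat a₁ b₁ c₁ d₁ · mat a₂ b₂ c₂ d₂ =
  mat (a₁ * a₂ + b₁ * c₂) (a₁ * b₂ + b₁ * d₂)
      (c₁ * a₂ + d₁ * c₂) (c₁ * b₂ + d₁ * d₂)

det : Mat2 → ℤ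
det (mat a b c d) = a * d - b * c

InSL2 : Mat2 → Set
InSL2 M = det M ≡ + 1

InS : Mat2 → Set
InS M = InSL2 M × (+ 0 < a M) × (a M < b M) × (b M < d M)
                  × (a M < c M) × (c M < d M)

module Submission where

-- Determinant is
-- multiplicative, so the product stays in SL₂(ℤ).  All entries of M and N
-- are positive, so each entry of M · N is a dot product of positive vectors,
-- and the four order conditions of the product are instances of one fact:
-- for a positive vector, the dot product is strictly monotone in the other
-- vector (entrywise strict order).  Comparing the two columns of N gives
-- A < B and C < D; comparing the two rows of M gives A < C and B < D.

open import Defs
open import Data.Integer using (ℤ; _+_; _-_; _*_; _<_; +_; positive)
open import Data.Integer.Properties
  using (<-trans; +-mono-<; *-monoˡ-<-pos; *-monoʳ-<-pos; *-zeroʳ)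
open import Data.Integer.Tactic.RingSolver using (solve-∀)
open import Data.Product using (_×_; _,_)
open import Relation.Binary.PropositionalEquality using (_≡_; cong₂; trans; subst)

det-· : (M N : Mat2) → det (M · N) ≡ det M * det N
det-· (mat a b c d) (mat a' b' c' d') = identity a b c d a' b' c' d'
  where
  identity : ∀ a b c d a' b' c' d' →
    (a * a' + b * c') * (c * b' + d * d') - (a * b' + b * d') * (c * a' + d * c')
    ≡ (a * d - b * c) * (a' * d' - b' * c')
  identity = solve-∀

InSL2-· : (M N : Mat2) → InSL2 M → InSL2 N → InSL2 (M · N)
InSL2-· M N detM detN = trans (det-· M N) (cong₂ _*_ detM detN)

Positive : ℤ → Set
Positive x = + 0 < x

AllPositive : Mat2 → Set
AllPositive M = Positive (a M) × Positive (b M) × Positive (c M) × Positive (d M)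

InS⇒AllPositive : (M : Mat2) → InS M → AllPositive M
InS⇒AllPositive M (_ , pa , ab , bd , ac , _) = pa , pb , <-trans pa ac , <-trans pb bd
  where pb = <-trans pa ab

*-monoˡ-< : ∀ {x y z} → Positive x → y < z → x * y < x * z
*-monoˡ-< {x} px = *-monoˡ-<-pos x {{positive px}}

*-monoʳ-< : ∀ {x y z} → Positive x → y < z → y * x < z * x
*-monoʳ-< {x} px = *-monoʳ-<-pos x {{positive px}}

*-pos : ∀ {x y} → Positive x → Positive y → Positive (x * y)
*-pos {x} px py = subst (_< x * _) (*-zeroʳ x) (*-monoˡ-< px py)

dot-monoʳ-< : ∀ {x u y v y' v'} → Positive x → Positive u →
              y < y' → v < v' → x * y + u * v < x * y' + u * v'
dot-monoʳ-< px pu y<y' v<v' = +-mono-< (*-monoˡ-< px y<y') (*-monoˡ-< pu v<v')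

dot-monoˡ-< : ∀ {x u x' u' y v} → Positive y → Positive v →
              x < x' → u < u' → x * y + u * v < x' * y + u' * v
dot-monoˡ-< py pv x<x' u<u' = +-mono-< (*-monoʳ-< py x<x') (*-monoʳ-< pv u<u')

proposition4p4 : (M N : Mat2) → InS M → InS N → InS (M · N)
proposition4p4 M N sM sN with InS⇒AllPositive M sM | InS⇒AllPositive N sN
proposition4p4 M@(mat a b c d) N@(mat a' b' c' d')
  (detM , _ , _ , b<d , a<c , _) (detN , _ , a'<b' , _ , _ , c'<d')
  | pa , pb , pc , pd | pa' , pb' , pc' , pd' =
  InSL2-· M N detM detN ,
  +-mono-< (*-pos pa pa') (*-pos pb pc') ,
  dot-monoʳ-< pa pb a'<b' c'<d' ,
  dot-monoˡ-< pb' pd' a<c b<d ,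
  dot-monoˡ-< pa' pc' a<c b<d ,
  dot-monoʳ-< pc pd a'<b' c'<d'
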